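{- Let $G$ be a graph, $\mathcal{P}=(X_1,\ldots,X_l)$ a path decomposition of width $k$ of $G$, and $S\subseteq V(G)$ such that the number $c$ of $S$-branches satisfies $c>k$. Let $H_1,\ldots,H_c$ be the $S$-branches ordered so that $\alpha(H_1)\leq\cdots\leq\alpha(H_c)$, and $H^1,\ldots,H^c$ the $S$-branches ordered so that $\beta(H^1)\leq\cdots\leq\beta(H^c)$. Then (i) $\alpha(H_i)\geq\alpha(x)$ for all $i\geq k+1$ and all $x\in S$; (ii) $\beta(H^i)\leq\beta(x)$ for all $i\leq c-k$ and all $x\in S$.
   Context: A path decomposition of $G$ is a sequence $(X_1,\ldots,X_l)$ of subsets of $V(G)$ with $\bigcup_iX_i=V(G)$, every edge inside some $X_i$, and $X_i\cap X_k\subseteq X_j$ for $i\leq j\leq k$; its width is $\max_i|X_i|-1$. For a subgraph $H$, $\alpha(H)=\min\{i:X_i\cap V(H)\neq\emptyset\}$, $\beta(H)=\max\{i:X_i\cap V(H)\neq\emptyset\}$; $\alpha(v),\beta(v)$ for a vertex $v$ are those of $G[\{v\}]$. For $S\subseteq V(G)$, an $S$-branch is a connected component $H$ of $G-S$ with $N_G(V(H))=S$ and $|V(H)|\geq 2$. -}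

module Defs where

open import Data.Nat using (ℕ; zero; suc; _+_; _≤_; _<_)
open import Data.Fin using (Fin; toℕ)
import Data.Fin as F
open import Data.Bool using (Bool; true; false; if_then_else_; _∧_; _∨_; not)
open import Data.Product using (Σ; ∃; _×_; _,_)
open import Relation.Binary.PropositionalEquality using (_≡_)
open import Function.Bundles using (_⇔_)
open import Relation.Nullary.Decidable.Core using (⌊_⌋)

VSet : ℕ → Set
VSet n = Fin n → Bool

_∈ˢ_ : ∀ {n} → Fin n → VSet n → Set
v ∈ˢ A = A v ≡ true

size : ∀ {n} → VSet n → ℕ
size {zero} A = 0
size {suc n} A = (if A F.zero then 1 else 0) + size (λ i → A (F.suc i))

anyB : ∀ {n} → (Fin n → Bool) → Bool
anyB {zero} f = false
anyB {suc n} f = f F.zero ∨ anyB (λ i → f (F.suc i))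

-- Least index i with f i = true (returns l if there is none).
firstIdx : ∀ {l} → (Fin l → Bool) → ℕ
firstIdx {zero} f = 0
firstIdx {suc l} f = if f F.zero then 0 else suc (firstIdx (λ i → f (F.suc i)))

-- Greatest index i with f i = true (returns 0 if there is none).
lastIdx : ∀ {l} → (Fin l → Bool) → ℕ
lastIdx {zero} f = 0
lastIdx {suc l} f =
  if anyB (λ i → f (F.suc i)) then suc (lastIdx (λ i → f (F.suc i))) else 0

record Graph (n : ℕ) : Set where
  field
    E     : Fin n → Fin n → Bool
    sym   : ∀ u v → E u v ≡ true → E v u ≡ true
    irref : ∀ v → E v v ≡ false
open Graph public

-- Path decomposition (X_1, ..., X_l), with bags indexed by Fin l (0-based).
record PathDecomposition {n : ℕ} (G : Graph n) : Set where
  field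
    len    : ℕ
    bag    : Fin len → VSet n
    cover  : ∀ v → ∃ λ i → v ∈ˢ bag i
    edges  : ∀ u v → E G u v ≡ true → ∃ λ i → (u ∈ˢ bag i) × (v ∈ˢ bag i)
    interp : ∀ (i j k : Fin len) → toℕ i ≤ toℕ j → toℕ j ≤ toℕ k →
             ∀ v → v ∈ˢ bag i → v ∈ˢ bag k → v ∈ˢ bag j
open PathDecomposition public

HasWidth : ∀ {n} {G : Graph n} → PathDecomposition G → ℕ → Set
HasWidth P k = (∀ i → size (bag P i) ≤ suc k) × (∃ λ i → size (bag P i) ≡ suc k)

meets : ∀ {n} {G : Graph n} (P : PathDecomposition G) → VSet n → Fin (len P) → Bool
meets P A i = anyB (λ v → bag P i v ∧ A v)

-- α(H), β(H) for a vertex set (0-based bag indices)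
α : ∀ {n} {G : Graph n} → PathDecomposition G → VSet n → ℕ
α P A = firstIdx (meets P A)

β : ∀ {n} {G : Graph n} → PathDecomposition G → VSet n → ℕ
β P A = lastIdx (meets P A)

single : ∀ {n} → Fin n → VSet n
single x v = ⌊ x F.≟ v ⌋

data Reach {n} (G : Graph n) (S : VSet n) (u : Fin n) : Fin n → Set where
  here : S u ≡ false → Reach G S u u
  step : ∀ {w v} → Reach G S u w → E G w v ≡ true → S v ≡ false → Reach G S u v

IsComponent : ∀ {n} → Graph n → VSet n → VSet n → Set
IsComponent G S H =
  (∀ v → v ∈ˢ H → S v ≡ false) ×
  (∃ λ v → v ∈ˢ H) ×
  (∀ u v → u ∈ˢ H → v ∈ˢ H → Reach G S u v) ×
  (∀ u v → u ∈ˢ H → S v ≡ false → E G u v ≡ true → v ∈ˢ H)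

InNbhd : ∀ {n} → Graph n → VSet n → Fin n → Set
InNbhd G H v = (H v ≡ false) × (∃ λ u → (u ∈ˢ H) × (E G u v ≡ true))

IsBranch : ∀ {n} → Graph n → VSet n → VSet n → Set
IsBranch G S H =
  IsComponent G S H ×
  (∀ v → (v ∈ˢ S) ⇔ InNbhd G H v) ×
  (2 ≤ size H)

EnumBranches : ∀ {n} → Graph n → VSet n → (c : ℕ) → (Fin c → VSet n) → Set
EnumBranches G S c H =
  (∀ i → IsBranch G S (H i)) ×
  (∀ i j → (∀ v → H i v ≡ H j v) → i ≡ j) ×
  (∀ B → IsBranch G S B → ∃ λ i → ∀ v → B v ≡ H i v)

-- Suppose x ∈ S and the bag t = α(x) comes strictly after α(H_{k+1}). Each of
-- H_1, …, H_{k+1} has a vertex in a bag before t, and, since x has a neighbour in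
-- it, a vertex in a bag with x, hence at or after t. Being connected, each of them
-- therefore meets bag t, which then holds x together with k + 1 distinct vertices
-- from disjoint branches, exceeding the width k. Part (ii) is the mirror image.
module Submission where

open import Defs hiding (sym)
open import Data.Nat using (ℕ; suc; _+_; _≤_; _<_; z≤n; s≤s)
open import Data.Nat.Properties
open import Data.Fin using (Fin; toℕ; fromℕ<)
import Data.Fin as F
import Data.Fin.Properties as FP
open import Data.Vec.Functional using (_∷_)
open import Data.Bool using (Bool; true; false; _∧_)
open import Data.Bool.Properties using (∨-zeroʳ)
open import Data.Product using (_×_; _,_; proj₁; proj₂; ∃)
open import Function using (_∘′_)
open import Function.Definitions using (Injective)
open import Function.Bundles using (Equivalence)
open import Relation.Nullary using (¬_; yes; no)
open import Relation.Nullary.Decidable using (isYes≗does; dec-true)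
open import Relation.Binary.PropositionalEquality

private
  variable
    n l c : ℕ

anyB-intro : (f : Fin n → Bool) (i : Fin n) → f i ≡ true → anyB f ≡ true
anyB-intro f F.zero fi rewrite fi = refl
anyB-intro f (F.suc i) fi rewrite anyB-intro (λ j → f (F.suc j)) i fi = ∨-zeroʳ (f F.zero)

anyB-elim : (f : Fin n → Bool) → anyB f ≡ true → ∃ λ i → f i ≡ true
anyB-elim {suc n} f any with f F.zero in f0
... | true = F.zero , f0
... | false with i , fi ← anyB-elim (λ j → f (F.suc j)) any = F.suc i , fi

firstIdx-least : (f : Fin l → Bool) (i : Fin l) → f i ≡ true → firstIdx f ≤ toℕ i
firstIdx-least f F.zero fi rewrite fi = z≤n
firstIdx-least f (F.suc i) fi with f F.zero
... | true  = z≤n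
... | false = s≤s (firstIdx-least (λ j → f (F.suc j)) i fi)

firstIdx-attained : (f : Fin l → Bool) (i : Fin l) → f i ≡ true →
                    ∃ λ j → toℕ j ≡ firstIdx f × f j ≡ true
firstIdx-attained {suc _} f i fi with f F.zero in f0
firstIdx-attained f i         fi | true  = F.zero , refl , f0
firstIdx-attained f F.zero    fi | false with () ← trans (sym f0) fi
firstIdx-attained f (F.suc i) fi | false
  with j , j≡ , fj ← firstIdx-attained (λ j → f (F.suc j)) i fi = F.suc j , cong suc j≡ , fj

lastIdx-greatest : (f : Fin l → Bool) (i : Fin l) → f i ≡ true → toℕ i ≤ lastIdx f
lastIdx-greatest f F.zero    fi = z≤n
lastIdx-greatest f (F.suc i) fi rewrite anyB-intro (λ j → f (F.suc j)) i fi =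
  s≤s (lastIdx-greatest (λ j → f (F.suc j)) i fi)

lastIdx-attained : (f : Fin l → Bool) (i : Fin l) → f i ≡ true →
                   ∃ λ j → toℕ j ≡ lastIdx f × f j ≡ true
lastIdx-attained {suc _} f i fi with anyB (λ j → f (F.suc j)) in anyTail
lastIdx-attained f i fi | true
  with i′ , fi′ ← anyB-elim (λ j → f (F.suc j)) anyTail
  with j , j≡ , fj ← lastIdx-attained (λ j → f (F.suc j)) i′ fi′ = F.suc j , cong suc j≡ , fj
lastIdx-attained f F.zero    fi | false = F.zero , refl , fi
lastIdx-attained f (F.suc i) fi | false
  with () ← trans (sym anyTail) (anyB-intro (λ j → f (F.suc j)) i fi)

-- Missing clauses are absurd: `with A F.zero` also abstracts the type of vA (resp. wA)
-- at v = zero, turning it into false ≡ true.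
rank : (A : VSet n) (v : Fin n) → v ∈ˢ A → Fin (size A)
rank A F.zero vA with A F.zero
... | true = F.zero
rank A (F.suc v) vA with A F.zero
... | true  = F.suc (rank (λ i → A (F.suc i)) v vA)
... | false = rank (λ i → A (F.suc i)) v vA

rank-injective : (A : VSet n) (v w : Fin n) (vA : v ∈ˢ A) (wA : w ∈ˢ A) →
                 rank A v vA ≡ rank A w wA → v ≡ w
rank-injective A F.zero F.zero vA wA with A F.zero
... | true = λ _ → refl
rank-injective A F.zero (F.suc w) vA wA with A F.zero
... | true = λ ()
rank-injective A (F.suc v) F.zero vA wA with A F.zero
... | true = λ ()
rank-injective A (F.suc v) (F.suc w) vA wA with A F.zero
... | true  = cong F.suc ∘′ rank-injective (λ i → A (F.suc i)) v w vA wA ∘′ FP.suc-injective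
... | false = cong F.suc ∘′ rank-injective (λ i → A (F.suc i)) v w vA wA

injection-≤-size : (A : VSet n) {m : ℕ} (f : Fin m → Fin n) → (∀ i → f i ∈ˢ A) →
                   Injective _≡_ _≡_ f → m ≤ size A
injection-≤-size A f fA f-inj =
  FP.injective⇒≤ (λ {i} {j} r → f-inj (rank-injective A (f i) (f j) (fA i) (fA j) r))

offset : ∀ {m} (o : ℕ) → o + m < c → Fin (suc m) → Fin c
offset o o+m<c r = fromℕ< (≤-<-trans (+-monoʳ-≤ o (≤-pred (FP.toℕ<n r))) o+m<c)

toℕ-offset : ∀ {m} (o : ℕ) (o+m<c : o + m < c) (r : Fin (suc m)) →
             toℕ (offset o o+m<c r) ≡ o + toℕ r
toℕ-offset o o+m<c r = FP.toℕ-fromℕ< _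

offset-injective : ∀ {m} (o : ℕ) (o+m<c : o + m < c) → Injective _≡_ _≡_ (offset o o+m<c)
offset-injective o o+m<c {r} {r′} eq = FP.toℕ-injective (+-cancelˡ-≡ o _ _ (begin
  o + toℕ r                  ≡⟨ toℕ-offset o o+m<c r ⟨
  toℕ (offset o o+m<c r)     ≡⟨ cong toℕ eq ⟩
  toℕ (offset o o+m<c r′)    ≡⟨ toℕ-offset o o+m<c r′ ⟩
  o + toℕ r′                 ∎))
  where open ≡-Reasoning

Closed : Graph n → VSet n → VSet n → Set
Closed G S H = ∀ u v → u ∈ˢ H → S v ≡ false → E G u v ≡ true → v ∈ˢ H

reach-closed : {G : Graph n} {S H : VSet n} → Closed G S H →
               ∀ {u v} → u ∈ˢ H → Reach G S u v → v ∈ˢ H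
reach-closed closed uH (here _)       = uH
reach-closed closed uH (step r e Sv) = closed _ _ (reach-closed closed uH r) Sv e

components-overlap⇒equal : {G : Graph n} {S H H′ : VSet n} →
                           IsComponent G S H → IsComponent G S H′ →
                           ∀ {v} → v ∈ˢ H → v ∈ˢ H′ → ∀ w → H w ≡ H′ w
components-overlap⇒equal {H = H} {H′} (_ , _ , reach , closed) (_ , _ , reach′ , closed′) vH vH′ w
  with H w in wH | H′ w in wH′
... | true  | true  = refl
... | false | false = refl
... | true  | false with () ← trans (sym wH′) (reach-closed closed′ vH′ (reach _ w vH wH))
... | false | true  with () ← trans (sym wH) (reach-closed closed vH (reach′ _ w vH′ wH′))

branches-disjoint : {G : Graph n} {S : VSet n} {H : Fin c → VSet n} → EnumBranches G S c H →
                    ∀ {i j v} → v ∈ˢ H i → v ∈ˢ H j → i ≡ j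
branches-disjoint (branch , distinct , _) vHi vHj =
  distinct _ _ (components-overlap⇒equal (proj₁ (branch _)) (proj₁ (branch _)) vHi vHj)

module _ {G : Graph n} (P : PathDecomposition G) where

  Meets : VSet n → Fin (len P) → Set
  Meets A t = ∃ λ v → v ∈ˢ A × v ∈ˢ bag P t

  meets-intro : ∀ {A t} → Meets A t → meets P A t ≡ true
  meets-intro {A} {t} (v , vA , vt) = anyB-intro (λ w → bag P t w ∧ A w) v (cong₂ _∧_ vt vA)

  meets-elim : ∀ {A t} → meets P A t ≡ true → Meets A t
  meets-elim {A} {t} m with v , _ ← anyB-elim (λ w → bag P t w ∧ A w) m
    with bag P t v in vt | A v in vA
  ... | true | true = v , vA , vt

  α-least : ∀ {A t} → Meets A t → α P A ≤ toℕ t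
  α-least m = firstIdx-least (meets P _) _ (meets-intro m)

  α-attained : ∀ {A t} → Meets A t → ∃ λ t₀ → toℕ t₀ ≡ α P A × Meets A t₀
  α-attained m with t₀ , t₀≡ , m₀ ← firstIdx-attained (meets P _) _ (meets-intro m) =
    t₀ , t₀≡ , meets-elim m₀

  β-greatest : ∀ {A t} → Meets A t → toℕ t ≤ β P A
  β-greatest m = lastIdx-greatest (meets P _) _ (meets-intro m)

  β-attained : ∀ {A t} → Meets A t → ∃ λ t₁ → toℕ t₁ ≡ β P A × Meets A t₁
  β-attained m with t₁ , t₁≡ , m₁ ← lastIdx-attained (meets P _) _ (meets-intro m) =
    t₁ , t₁≡ , meets-elim m₁

  meets-single : ∀ {x t} → x ∈ˢ bag P t → Meets (single x) t
  meets-single {x} xt = x , trans (isYes≗does (x F.≟ x)) (dec-true (x F.≟ x) refl) , xt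

  single-meets : ∀ {x t} → Meets (single x) t → x ∈ˢ bag P t
  single-meets {x} {t} (v , xv , vt) with x F.≟ v
  ... | yes refl = vt

  -- A walk cannot jump over a bag: its last edge lies in some bag s, and either
  -- t ≤ s (recurse on the shorter walk) or the endpoint lies in both s < t and t₁ ≥ t.
  walk-meets-bag : ∀ {S u v t₀ t t₁} → Reach G S u v → u ∈ˢ bag P t₀ → v ∈ˢ bag P t₁ →
                   toℕ t₀ ≤ toℕ t → toℕ t ≤ toℕ t₁ → ∃ λ w → Reach G S u w × w ∈ˢ bag P t
  walk-meets-bag {u = u} {t₀ = t₀} {t} {t₁} (here Su) ut₀ ut₁ t₀≤t t≤t₁ =
    u , here Su , interp P t₀ t t₁ t₀≤t t≤t₁ u ut₀ ut₁
  walk-meets-bag {t = t} {t₁} (step {w} {v} r e Sv) ut₀ vt₁ t₀≤t t≤t₁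
    with s , ws , vs ← edges P w v e
    with toℕ t ≤? toℕ s
  ... | yes t≤s = walk-meets-bag r ut₀ ws t₀≤t t≤s
  ... | no  t≰s = v , step r e Sv , interp P s t t₁ (<⇒≤ (≰⇒> t≰s)) t≤t₁ v vs vt₁

  component-meets-bag-between : ∀ {S B t₀ t t₁} → IsComponent G S B →
                                Meets B t₀ → Meets B t₁ → toℕ t₀ ≤ toℕ t → toℕ t ≤ toℕ t₁ →
                                Meets B t
  component-meets-bag-between (_ , _ , reach , closed) (u , uB , ut₀) (v , vB , vt₁) t₀≤t t≤t₁
    with w , r , wt ← walk-meets-bag (reach u v uB vB) ut₀ vt₁ t₀≤t t≤t₁ =
    w , reach-closed closed uB r , wt

  branch-shares-bag : ∀ {S B x} → IsBranch G S B → x ∈ˢ S → ∃ λ s → Meets B s × x ∈ˢ bag P s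
  branch-shares-bag (_ , neighbourhood , _) xS
    with _ , u , uB , e ← Equivalence.to (neighbourhood _) xS
    with s , us , xs ← edges P u _ e = s , (u , uB , us) , xs

  branch-meets-first-bag : ∀ {S B x t} → IsBranch G S B → x ∈ˢ S →
                           (∀ s → x ∈ˢ bag P s → toℕ t ≤ toℕ s) → α P B ≤ toℕ t → Meets B t
  branch-meets-first-bag branch@((_ , (v , vB) , _) , _) xS t-first αB≤t
    with t₀ , t₀≡ , m₀ ← α-attained (v , vB , proj₂ (cover P v))
    with s , m , xs ← branch-shares-bag branch xS =
    component-meets-bag-between (proj₁ branch) m₀ m (subst (_≤ _) (sym t₀≡) αB≤t) (t-first s xs)

  branch-meets-last-bag : ∀ {S B x t} → IsBranch G S B → x ∈ˢ S →
                          (∀ s → x ∈ˢ bag P s → toℕ s ≤ toℕ t) → toℕ t ≤ β P B → Meets B t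
  branch-meets-last-bag branch@((_ , (v , vB) , _) , _) xS t-last t≤βB
    with t₁ , t₁≡ , m₁ ← β-attained (v , vB , proj₂ (cover P v))
    with s , m , xs ← branch-shares-bag branch xS =
    component-meets-bag-between (proj₁ branch) m m₁ (t-last s xs) (subst (_ ≤_) (sym t₁≡) t≤βB)

  bag-size-≥-branches : ∀ {S x t m} {H : Fin c → VSet n} → EnumBranches G S c H →
                        x ∈ˢ S → x ∈ˢ bag P t →
                        (j : Fin m → Fin c) → Injective _≡_ _≡_ j → (∀ r → Meets (H (j r)) t) →
                        suc m ≤ size (bag P t)
  bag-size-≥-branches {S = S} {x} {t} {m} {H} enum xS xt j j-injective meets-t =
    injection-≤-size (bag P t) (x ∷ w) inBag inj
    where
    w : Fin m → Fin n
    w r = proj₁ (meets-t r)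

    w∈H : ∀ r → w r ∈ˢ H (j r)
    w∈H r = proj₁ (proj₂ (meets-t r))

    w∉S : ∀ r → S (w r) ≡ false
    w∉S r = proj₁ (proj₁ (proj₁ enum (j r))) (w r) (w∈H r)

    x≢w : ∀ r → x ≢ w r
    x≢w r refl with () ← trans (sym xS) (w∉S r)

    inBag : ∀ r → (x ∷ w) r ∈ˢ bag P t
    inBag F.zero    = xt
    inBag (F.suc r) = proj₂ (proj₂ (meets-t r))

    inj : Injective _≡_ _≡_ (x ∷ w)
    inj {F.zero}  {F.zero}   _  = refl
    inj {F.zero}  {F.suc r}  eq with () ← x≢w r eq
    inj {F.suc r} {F.zero}   eq with () ← x≢w r (sym eq)
    inj {F.suc r} {F.suc r′} eq =
      cong F.suc (j-injective (branches-disjoint enum (w∈H r) (subst (_∈ˢ H (j r′)) (sym eq) (w∈H r′))))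

  bag-cannot-meet-k+1-branches : ∀ {k S x t o} {H : Fin c → VSet n} →
                                 (∀ i → size (bag P i) ≤ suc k) → EnumBranches G S c H →
                                 x ∈ˢ S → x ∈ˢ bag P t → (o+k<c : o + k < c) →
                                 ¬ (∀ r → Meets (H (offset o o+k<c r)) t)
  bag-cannot-meet-k+1-branches {k = k} {t = t} {o = o} width enum xS xt o+k<c meets-t =
    n≮n (suc k) (≤-trans overfull (width t))
    where
    overfull : suc (suc k) ≤ size (bag P t)
    overfull = bag-size-≥-branches enum xS xt (offset o o+k<c) (offset-injective o o+k<c) meets-t

  α-single-≤-α-late-branch : ∀ {k S x} {H : Fin c → VSet n} →
                             (∀ i → size (bag P i) ≤ suc k) → EnumBranches G S c H →
                             (∀ i j → toℕ i ≤ toℕ j → α P (H i) ≤ α P (H j)) →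
                             (i : Fin c) → k ≤ toℕ i → x ∈ˢ S → α P (single x) ≤ α P (H i)
  α-single-≤-α-late-branch {x = x} width enum α-mono i k≤i xS = ≮⇒≥ λ αHi<αx →
    let t , t≡ , mt  = α-attained (meets-single (proj₂ (cover P x)))
        k<c          = ≤-<-trans k≤i (FP.toℕ<n i)
        early r      = ≤-trans (≤-reflexive (toℕ-offset 0 k<c r)) (≤-trans (≤-pred (FP.toℕ<n r)) k≤i)
        t-first s xs = subst (_≤ toℕ s) (sym t≡) (α-least (meets-single xs))
        αH≤t r       = ≤-trans (α-mono _ i (early r)) (≤-trans (<⇒≤ αHi<αx) (≤-reflexive (sym t≡)))
    in bag-cannot-meet-k+1-branches width enum xS (single-meets mt) k<c λ r →
         branch-meets-first-bag (proj₁ enum _) xS t-first (αH≤t r)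

  β-early-branch-≤-β-single : ∀ {k S x} {H : Fin c → VSet n} →
                              (∀ i → size (bag P i) ≤ suc k) → EnumBranches G S c H →
                              (∀ i j → toℕ i ≤ toℕ j → β P (H i) ≤ β P (H j)) →
                              (i : Fin c) → toℕ i + k < c → x ∈ˢ S → β P (H i) ≤ β P (single x)
  β-early-branch-≤-β-single {x = x} width enum β-mono i i+k<c xS = ≮⇒≥ λ βx<βHi →
    let t , t≡ , mt = β-attained (meets-single (proj₂ (cover P x)))
        late r      = ≤-trans (m≤m+n (toℕ i) _) (≤-reflexive (sym (toℕ-offset (toℕ i) i+k<c r)))
        t-last s xs = subst (toℕ s ≤_) (sym t≡) (β-greatest (meets-single xs))
        t≤βH r      = ≤-trans (≤-reflexive t≡) (≤-trans (<⇒≤ βx<βHi) (β-mono i _ (late r)))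
    in bag-cannot-meet-k+1-branches width enum xS (single-meets mt) i+k<c λ r →
         branch-meets-last-bag (proj₁ enum _) xS t-last (t≤βH r)

lemma15 : ∀ {n} (G : Graph n) (P : PathDecomposition G) (k : ℕ) → HasWidth P k →
          (S : VSet n) (c : ℕ) → k < c →
          (H : Fin c → VSet n) → EnumBranches G S c H →
          (∀ i j → toℕ i ≤ toℕ j → α P (H i) ≤ α P (H j)) →
          (H′ : Fin c → VSet n) → EnumBranches G S c H′ →
          (∀ i j → toℕ i ≤ toℕ j → β P (H′ i) ≤ β P (H′ j)) →
          (∀ (i : Fin c) x → k ≤ toℕ i → x ∈ˢ S → α P (single x) ≤ α P (H i)) ×
          (∀ (i : Fin c) x → toℕ i + k < c → x ∈ˢ S → β P (H′ i) ≤ β P (single x))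
lemma15 G P k (width , _) S c _ H enum α-mono H′ enum′ β-mono =
  (λ i _ → α-single-≤-α-late-branch P width enum α-mono i) ,
  (λ i _ → β-early-branch-≤-β-single P width enum′ β-mono i)
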